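{- Let $G'$ be a finite simple graph. Let $P_k$ be a maximal pendent path of length $k$ attached to a vertex $u$ with $\deg_{G'}(u)=x\ge3$, and let $P_j$ be another maximal pendent path of length $j$ attached to a vertex $v$ with $\deg_{G'}(v)=y$, where $x\ge y\ge3$. Let $z$ be the endpoint of $P_j$ of degree $1$ and $w$ the neighbour of $u$ on $P_k$. Let $G=G'-uw+zw$. Then $\mathrm{SO}(G')>\mathrm{SO}(G)$.
   Context: For a graph $G$, $\mathrm{SO}(G)=\sum_{ab\in E(G)}\sqrt{\deg_G(a)^2+\deg_G(b)^2}$. A maximal pendent path of length $k\ge1$ attached to $u$ is a path $u=p_0,p_1,\dots,p_k$ in which $\deg(p_k)=1$, $\deg(p_i)=2$ for $0<i<k$, and $\deg(u)\ge3$. -}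

module Defs where

open import Data.Bool using (Bool; true; false; if_then_else_; _∧_; _∨_)
open import Data.Nat using (ℕ; zero; suc; _≤_; _<_; _<ᵇ_; _*_; s≤s; z≤n)
import Data.Nat as ℕ
open import Data.Fin using (Fin; toℕ; fromℕ; fromℕ<; inject₁)
open import Data.Fin using (_≟_)
open import Data.List using (List; []; _∷_; map; concatMap; allFin; foldr; length)
open import Data.List.Relation.Binary.Pointwise using (Pointwise)
open import Data.Integer using (+_)
open import Data.Rational using (ℚ; 0ℚ; _/_) renaming (_≤_ to _≤ℚ_; _<_ to _<ℚ_; _+_ to _+ℚ_; _*_ to _*ℚ_)
open import Data.Product using (Σ; _×_; _,_)
open import Relation.Binary.PropositionalEquality using (_≡_)
open import Relation.Nullary.Decidable using (⌊_⌋)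

Adj : ℕ → Set
Adj n = Fin n → Fin n → Bool

IsSimple : ∀ {n} → Adj n → Set
IsSimple {n} adj = (∀ a b → adj a b ≡ adj b a) × (∀ a → adj a a ≡ false)

deg : ∀ {n} → Adj n → Fin n → ℕ
deg {n} adj a = foldr ℕ._+_ 0 (map (λ b → if adj a b then 1 else 0) (allFin n))

radicands : ∀ {n} → Adj n → List ℕ
radicands {n} adj =
  concatMap (λ a → concatMap (λ b →
      if (toℕ a <ᵇ toℕ b) ∧ adj a b
      then (deg adj a * deg adj a ℕ.+ deg adj b * deg adj b) ∷ []
      else []) (allFin n)) (allFin n)

ℕtoℚ : ℕ → ℚ
ℕtoℚ m = (+ m) / 1

sumℚ : List ℚ → ℚ
sumℚ = foldr _+ℚ_ 0ℚ

-- SqrtSumLt bs as  expresses the real inequality  Σ_{b∈bs} √b < Σ_{a∈as} √a,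
-- via rational lower bounds l for √a (0 ≤ l, l² ≤ a) and rational upper
-- bounds u for √b (0 ≤ u, b ≤ u²) with Σ u < Σ l.
SqrtSumLt : List ℕ → List ℕ → Set
SqrtSumLt bs as =
  Σ (List ℚ) λ us → Σ (List ℚ) λ ls →
    Pointwise (λ b u → (0ℚ ≤ℚ u) × (ℕtoℚ b ≤ℚ (u *ℚ u))) bs us ×
    Pointwise (λ a l → (0ℚ ≤ℚ l) × ((l *ℚ l) ≤ℚ ℕtoℚ a)) as ls ×
    (sumℚ us <ℚ sumℚ ls)

SOlt : ∀ {n} → Adj n → Adj n → Set
SOlt G G' = SqrtSumLt (radicands G) (radicands G')

record PendentPath {n : ℕ} (adj : Adj n) (u : Fin n) (k : ℕ) : Set where
  field
    lenPos   : 1 ≤ k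
    p        : Fin (suc k) → Fin n
    injective : ∀ i j → p i ≡ p j → i ≡ j
    start    : p Data.Fin.zero ≡ u
    adjacent : ∀ (i : Fin k) → adj (p (inject₁ i)) (p (Data.Fin.suc i)) ≡ true
    endDeg   : deg adj (p (fromℕ k)) ≡ 1
    midDeg   : ∀ (i : Fin (suc k)) → 0 < toℕ i → toℕ i < k → deg adj (p i) ≡ 2
    rootDeg  : 3 ≤ deg adj u

  endpoint : Fin n
  endpoint = p (fromℕ k)

  second : Fin n
  second = p (fromℕ< (s≤s lenPos))

sameEdge : ∀ {n} → Fin n → Fin n → Fin n → Fin n → Bool
sameEdge a b x y = (⌊ a ≟ x ⌋ ∧ ⌊ b ≟ y ⌋) ∨ (⌊ a ≟ y ⌋ ∧ ⌊ b ≟ x ⌋)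

moveEdge : ∀ {n} → Adj n → Fin n → Fin n → Fin n → Adj n
moveEdge adj u w z a b =
  if sameEdge a b u w then false
  else if sameEdge a b z w then true
  else adj a b

{-# OPTIONS --safe #-}
-- Moving the edge uw to zw raises no degree except that of z, from 1 to 2 (w loses u but
-- gains z). So every term √(d_a² + d_b²) of SO(G) is at most the matching term of
-- SO(G'), except on three edges: G' loses √(x² + d_w²) on uw, G gains at most √(4 + d_w²) on zw,
-- and the pendent edge zq grows from √(1 + d_q²) to at most √(4 + d_q²). As x ≥ 3, d_w ≤ 2 and
-- d_q ≥ 2, the loss on uw exceeds the gain on zw by more than 0.77, while zq grows by less than 0.6.
-- The rational certificate bounds √r by ⌊M√r⌋/M ≤ √r < (⌊M√r⌋ + 1)/M with M = 100 (N + 1), where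
-- N = n² bounds the number of edges, so the rounding errors add up to less than 0.01.
module Submission where

open import Defs
open import Data.Bool.Base using (Bool; true; false; if_then_else_; _∧_; T)
open import Data.Bool.Properties using (∧-zeroʳ)
open import Data.Fin.Base using (Fin; zero; suc; toℕ; punchIn; punchOut; inject₁; fromℕ)
open import Data.Fin.Properties
  using (_≟_; toℕ-injective; punchInᵢ≢i; punchIn-injective; punchIn-punchOut; toℕ-inject₁; toℕ<n)
open import Data.Integer.Base as ℤ using (+≤+; +<+)
import Data.Integer.Properties as ℤ
import Data.Integer.Tactic.RingSolver as ℤ-Solver
open import Data.List.Base using (List; []; _∷_; _++_; map; concatMap; allFin; tabulate)
open import Data.List.Properties using (map-++; map-tabulate)
open import Data.List.Relation.Binary.Pointwise using (Pointwise; []; _∷_)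
open import Data.Nat.Base hiding (_/_)
open import Data.Nat.Properties hiding (_≟_)
open import Algebra.Properties.CommutativeMonoid.Sum +-0-commutativeMonoid
  using (sum-syntax; ∑-distrib-+; sum-cong-≗; sum-remove; sum-replicate-zero)
  renaming (sum to ∑)
open import Algebra.Properties.CommutativeSemigroup +-commutativeSemigroup using (x∙yz≈y∙xz)
open import Data.Nat.ListAction using (sum)
open import Data.Nat.ListAction.Properties using (sum-++)
open import Data.Nat.Tactic.RingSolver using (solve-∀)
open import Data.Product.Base using (_×_; _,_; proj₁; proj₂; ∃-syntax)
open import Data.Rational.Base using (ℚ; 0ℚ; _/_; toℚᵘ)
  renaming (_≤_ to _≤ℚ_; _<_ to _<ℚ_; _+_ to _+ℚ_; _*_ to _*ℚ_)
open import Data.Rational.Properties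
  using (toℚᵘ-fromℚᵘ; toℚᵘ-homo-+; toℚᵘ-homo-*; toℚᵘ-injective; toℚᵘ-cancel-≤; toℚᵘ-cancel-<)
open import Data.Rational.Unnormalised.Base as ℚᵘ using (mkℚᵘ; _≃_; *≡*; *≤*; *<*)
import Data.Rational.Unnormalised.Properties as ℚᵘ
open import Data.Sum.Base using (_⊎_; inj₁; inj₂; [_,_]′)
open import Data.Unit.Base using (tt)
open import Function.Base using (_∘_; id)
open import Relation.Binary.PropositionalEquality
open import Relation.Nullary.Decidable.Core using (Dec; yes; no; _because_; isYes; from-no)
open import Relation.Nullary.Negation using (¬_; contradiction)
open import Relation.Nullary.Reflects using (Reflects; ofʸ; ofⁿ; _×-reflects_; _⊎-reflects_)

private
  variable
    n : ℕ

-- Integer square roots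

⌊√_⌋ : ℕ → ℕ
⌊√ zero ⌋ = zero
⌊√ suc n ⌋ with suc ⌊√ n ⌋ * suc ⌊√ n ⌋ ≤ᵇ suc n
... | true  = suc ⌊√ n ⌋
... | false = ⌊√ n ⌋

⌊√n⌋²≤n : ∀ n → ⌊√ n ⌋ * ⌊√ n ⌋ ≤ n
⌊√n⌋²≤n zero = z≤n
⌊√n⌋²≤n (suc n) with suc ⌊√ n ⌋ * suc ⌊√ n ⌋ ≤ᵇ suc n in eq
... | true  = ≤ᵇ⇒≤ _ _ (subst T (sym eq) tt)
... | false = m≤n⇒m≤1+n (⌊√n⌋²≤n n)

n<[1+⌊√n⌋]² : ∀ n → n < suc ⌊√ n ⌋ * suc ⌊√ n ⌋
n<[1+⌊√n⌋]² zero = s≤s z≤n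
n<[1+⌊√n⌋]² (suc n) with suc ⌊√ n ⌋ * suc ⌊√ n ⌋ ≤ᵇ suc n in eq
... | true  = ≤-<-trans (n<[1+⌊√n⌋]² n) (*-mono-< (n<1+n (suc ⌊√ n ⌋)) (n<1+n (suc ⌊√ n ⌋)))
... | false = ≰⇒> (λ le → subst T eq (≤⇒≤ᵇ le))

m²≤n⇒m≤⌊√n⌋ : ∀ {m n} → m * m ≤ n → m ≤ ⌊√ n ⌋
m²≤n⇒m≤⌊√n⌋ {m} {n} m²≤n = ≮⇒≥ λ √n<m →
  <⇒≱ (n<[1+⌊√n⌋]² n) (≤-trans (*-mono-≤ √n<m √n<m) m²≤n)

n<m²⇒⌊√n⌋<m : ∀ {m n} → n < m * m → ⌊√ n ⌋ < m
n<m²⇒⌊√n⌋<m {m} {n} n<m² = ≰⇒> λ m≤√n →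
  <⇒≱ n<m² (≤-trans (*-mono-≤ m≤√n m≤√n) (⌊√n⌋²≤n n))

⌊√⌋-mono-≤ : ∀ {m n} → m ≤ n → ⌊√ m ⌋ ≤ ⌊√ n ⌋
⌊√⌋-mono-≤ {m} m≤n = m²≤n⇒m≤⌊√n⌋ (≤-trans (⌊√n⌋²≤n m) m≤n)

module ScaledSqrt (m : ℕ) .{{_ : NonZero m}} where

  M : ℕ
  M = 100 * m

  ⌊M√_⌋ : ℕ → ℕ
  ⌊M√ r ⌋ = ⌊√ r * (M * M) ⌋

  ⌊M√⌋-mono-≤ : ∀ {r₁ r₂} → r₁ ≤ r₂ → ⌊M√ r₁ ⌋ ≤ ⌊M√ r₂ ⌋
  ⌊M√⌋-mono-≤ r₁≤r₂ = ⌊√⌋-mono-≤ (*-monoˡ-≤ (M * M) r₁≤r₂)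

  private
    [am]²≡a²m² : ∀ a m → (a * m) * (a * m) ≡ (a * a) * (m * m)
    [am]²≡a²m² = solve-∀
    cM²≡c10⁴m² : ∀ c m → c * (100 * m * (100 * m)) ≡ c * 10000 * (m * m)
    cM²≡c10⁴m² = solve-∀

  a*m≤⌊M√r⌋ : ∀ a c {r} → a * a ≤ c * 10000 → c ≤ r → a * m ≤ ⌊M√ r ⌋
  a*m≤⌊M√r⌋ a c {r} a²≤c10⁴ c≤r = m²≤n⇒m≤⌊√n⌋ (begin
    (a * m) * (a * m)     ≡⟨ [am]²≡a²m² a m ⟩
    (a * a) * (m * m)     ≤⟨ *-monoˡ-≤ (m * m) a²≤c10⁴ ⟩
    c * 10000 * (m * m)   ≡⟨ cM²≡c10⁴m² c m ⟨
    c * (M * M)           ≤⟨ *-monoˡ-≤ (M * M) c≤r ⟩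
    r * (M * M)           ∎)
    where open ≤-Reasoning

  ⌊M√r⌋<a*m : ∀ a c {r} → r ≤ c → c * 10000 < a * a → ⌊M√ r ⌋ < a * m
  ⌊M√r⌋<a*m a c {r} r≤c c10⁴<a² = n<m²⇒⌊√n⌋<m (begin-strict
    r * (M * M)           ≤⟨ *-monoˡ-≤ (M * M) r≤c ⟩
    c * (M * M)           ≡⟨ cM²≡c10⁴m² c m ⟩
    c * 10000 * (m * m)   <⟨ *-monoˡ-< (m * m) {{m*n≢0 m m}} c10⁴<a² ⟩
    (a * a) * (m * m)     ≡⟨ [am]²≡a²m² a m ⟨
    (a * m) * (a * m)     ∎)
    where open ≤-Reasoning

  ⌊M√⌋-gap : ∀ a b c₁ c₂ g {r₁ r₂} → r₁ ≤ c₁ → c₁ * 10000 < a * a →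
             b * b ≤ c₂ * 10000 → c₂ ≤ r₂ → a + g ≤ b → ⌊M√ r₁ ⌋ + g * m ≤ ⌊M√ r₂ ⌋
  ⌊M√⌋-gap a b c₁ c₂ g {r₁} {r₂} r₁≤c₁ c₁<a² b²≤c₂ c₂≤r₂ a+g≤b = begin
    ⌊M√ r₁ ⌋ + g * m ≤⟨ +-monoˡ-≤ (g * m) (<⇒≤ (⌊M√r⌋<a*m a c₁ r₁≤c₁ c₁<a²)) ⟩
    a * m + g * m    ≡⟨ *-distribʳ-+ m a g ⟨
    (a + g) * m      ≤⟨ *-monoˡ-≤ m a+g≤b ⟩
    b * m            ≤⟨ a*m≤⌊M√r⌋ b c₂ b²≤c₂ c₂≤r₂ ⟩
    ⌊M√ r₂ ⌋         ∎
    where open ≤-Reasoning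

  -- √4 < 2.01, √5 < 2.24 and √8 < 2.83, against √9 ≥ 3.00, √10 ≥ 3.16 and √13 ≥ 3.60.
  ⌊M√⌋-gain : ∀ x d → 3 ≤ x → d ≤ 2 → ⌊M√ 4 + d * d ⌋ + 77 * m ≤ ⌊M√ x * x + d * d ⌋
  ⌊M√⌋-gain x 0 3≤x _ =
    ⌊M√⌋-gap 201 300 4 9 77 ≤-refl (≤ᵇ⇒≤ _ _ tt) (≤ᵇ⇒≤ _ _ tt) (+-monoˡ-≤ 0 (*-mono-≤ 3≤x 3≤x)) (≤ᵇ⇒≤ _ _ tt)
  ⌊M√⌋-gain x 1 3≤x _ =
    ⌊M√⌋-gap 224 316 5 10 77 ≤-refl (≤ᵇ⇒≤ _ _ tt) (≤ᵇ⇒≤ _ _ tt) (+-monoˡ-≤ 1 (*-mono-≤ 3≤x 3≤x)) (≤ᵇ⇒≤ _ _ tt)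
  ⌊M√⌋-gain x 2 3≤x _ =
    ⌊M√⌋-gap 283 360 8 13 77 ≤-refl (≤ᵇ⇒≤ _ _ tt) (≤ᵇ⇒≤ _ _ tt) (+-monoˡ-≤ 4 (*-mono-≤ 3≤x 3≤x)) (≤ᵇ⇒≤ _ _ tt)
  ⌊M√⌋-gain x (suc (suc (suc _))) _ (s≤s (s≤s ()))

  -- Since 1 + d² ≥ 5, e = ⌊M√(1 + d²)⌋ ≥ 200m, so (e + 1 + 65m)² > (1 + d²)M² + (130·200 + 65²)m²,
  -- which exceeds (4 + d²)M² = (1 + d²)M² + 30000m².
  ⌊M√⌋-loss : ∀ d → 2 ≤ d → ⌊M√ 4 + d * d ⌋ ≤ ⌊M√ 1 + d * d ⌋ + 65 * m
  ⌊M√⌋-loss d 2≤d = s≤s⁻¹ (n<m²⇒⌊√n⌋<m (begin-strict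
      (4 + d * d) * (M * M)                          ≡⟨ [4+D]M²≡[1+D]M²+30000m² (d * d) m ⟩
      (1 + d * d) * (M * M) + 30000 * (m * m)        <⟨ +-monoˡ-< _ (n<[1+⌊√n⌋]² ((1 + d * d) * (M * M))) ⟩
      suc e * suc e + 30000 * (m * m)                ≤⟨ +-monoʳ-≤ (suc e * suc e) 30000m²≤130m[1+e]+65²m² ⟩
      suc e * suc e + (130 * m * suc e + 4225 * (m * m)) ≡⟨ [1+e+65m]² (suc e) m ⟨
      (suc e + 65 * m) * (suc e + 65 * m)            ∎))
    where
      open ≤-Reasoning
      e : ℕ
      e = ⌊M√ 1 + d * d ⌋
      [4+D]M²≡[1+D]M²+30000m² : ∀ D m →
        (4 + D) * (100 * m * (100 * m)) ≡ (1 + D) * (100 * m * (100 * m)) + 30000 * (m * m)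
      [4+D]M²≡[1+D]M²+30000m² = solve-∀
      [1+e+65m]² : ∀ x m → (x + 65 * m) * (x + 65 * m) ≡ x * x + (130 * m * x + 4225 * (m * m))
      [1+e+65m]² = solve-∀
      30225m²≡130m[200m]+65²m² : ∀ m → 30225 * (m * m) ≡ 130 * m * (200 * m) + 4225 * (m * m)
      30225m²≡130m[200m]+65²m² = solve-∀
      200m≤e : 200 * m ≤ e
      200m≤e = a*m≤⌊M√r⌋ 200 5 (≤ᵇ⇒≤ _ _ tt) (s≤s (*-mono-≤ 2≤d 2≤d))
      30000m²≤130m[1+e]+65²m² : 30000 * (m * m) ≤ 130 * m * suc e + 4225 * (m * m)
      30000m²≤130m[1+e]+65²m² = begin
        30000 * (m * m)                         ≤⟨ *-monoˡ-≤ (m * m) (≤ᵇ⇒≤ 30000 30225 tt) ⟩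
        30225 * (m * m)                         ≡⟨ 30225m²≡130m[200m]+65²m² m ⟩
        130 * m * (200 * m) + 4225 * (m * m)    ≤⟨ +-monoˡ-≤ _ (*-monoʳ-≤ (130 * m) (m≤n⇒m≤1+n 200m≤e)) ⟩
        130 * m * suc e + 4225 * (m * m)        ∎

-- Rational certificates for sums of square roots

module ScaledRationals (D : ℕ) where

  open import Data.Integer.Base using (+_)

  private
    M : ℕ
    M = suc D

    mkℚᵘ-mono-≤ : ∀ {a c} d₁ d₂ → a * suc d₂ ≤ c * suc d₁ → mkℚᵘ (+ a) d₁ ℚᵘ.≤ mkℚᵘ (+ c) d₂
    mkℚᵘ-mono-≤ {a} {c} d₁ d₂ le = *≤* (subst₂ ℤ._≤_ (ℤ.pos-* a (suc d₂)) (ℤ.pos-* c (suc d₁)) (+≤+ le))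

  infix 8 _/M
  _/M : ℕ → ℚ
  k /M = + k / M

  private
    toℚᵘ-/M : ∀ k → toℚᵘ (k /M) ≃ mkℚᵘ (+ k) D
    toℚᵘ-/M k = toℚᵘ-fromℚᵘ (mkℚᵘ (+ k) D)

    toℚᵘ-/M² : ∀ k → toℚᵘ (k /M *ℚ k /M) ≃ mkℚᵘ (+ (k * k)) (pred (M * M))
    toℚᵘ-/M² k = ℚᵘ.≃-trans (toℚᵘ-homo-* (k /M) (k /M))
      (ℚᵘ.≃-trans (ℚᵘ.*-cong (toℚᵘ-/M k) (toℚᵘ-/M k)) (ℚᵘ.≃-reflexive (cong (λ i → mkℚᵘ i _) (sym (ℤ.pos-* k k)))))

  0≤/M : ∀ k → 0ℚ ≤ℚ k /M
  0≤/M k = toℚᵘ-cancel-≤ (ℚᵘ.≤-respʳ-≃ (ℚᵘ.≃-sym (toℚᵘ-/M k)) (mkℚᵘ-mono-≤ 0 D z≤n))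

  ≤[/M]² : ∀ b k → b * (M * M) ≤ k * k → ℕtoℚ b ≤ℚ k /M *ℚ k /M
  ≤[/M]² b k le = toℚᵘ-cancel-≤ (ℚᵘ.≤-respʳ-≃ (ℚᵘ.≃-sym (toℚᵘ-/M² k))
    (ℚᵘ.≤-respˡ-≃ (ℚᵘ.≃-sym (toℚᵘ-fromℚᵘ (mkℚᵘ (+ b) 0)))
      (mkℚᵘ-mono-≤ 0 _ (subst (b * (M * M) ≤_) (sym (*-identityʳ (k * k))) le))))

  [/M]²≤ : ∀ a k → k * k ≤ a * (M * M) → k /M *ℚ k /M ≤ℚ ℕtoℚ a
  [/M]²≤ a k le = toℚᵘ-cancel-≤ (ℚᵘ.≤-respˡ-≃ (ℚᵘ.≃-sym (toℚᵘ-/M² k))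
    (ℚᵘ.≤-respʳ-≃ (ℚᵘ.≃-sym (toℚᵘ-fromℚᵘ (mkℚᵘ (+ a) 0)))
      (mkℚᵘ-mono-≤ _ 0 (subst (_≤ a * (M * M)) (sym (*-identityʳ (k * k))) le))))

  /M-mono-< : ∀ {k l} → k < l → k /M <ℚ l /M
  /M-mono-< {k} {l} k<l = toℚᵘ-cancel-< (ℚᵘ.<-respˡ-≃ (ℚᵘ.≃-sym (toℚᵘ-/M k)) (ℚᵘ.<-respʳ-≃ (ℚᵘ.≃-sym (toℚᵘ-/M l))
    (*<* (subst₂ ℤ._<_ (ℤ.pos-* k M) (ℤ.pos-* l M) (+<+ (*-monoˡ-< M k<l))))))

  0/M≡0 : 0 /M ≡ 0ℚ
  0/M≡0 = toℚᵘ-injective (ℚᵘ.≃-trans (toℚᵘ-/M 0) (*≡* refl))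

  /M-homo-+ : ∀ k l → (k + l) /M ≡ k /M +ℚ l /M
  /M-homo-+ k l = toℚᵘ-injective (begin-equality
      toℚᵘ ((k + l) /M)                  ≃⟨ toℚᵘ-/M (k + l) ⟩
      mkℚᵘ (+ (k + l)) D                  ≃⟨ *≡* cross ⟩
      mkℚᵘ (+ k) D ℚᵘ.+ mkℚᵘ (+ l) D      ≃⟨ ℚᵘ.+-cong (toℚᵘ-/M k) (toℚᵘ-/M l) ⟨
      toℚᵘ (k /M) ℚᵘ.+ toℚᵘ (l /M)        ≃⟨ toℚᵘ-homo-+ (k /M) (l /M) ⟨
      toℚᵘ (k /M +ℚ l /M)                 ∎)
    where
      open ℚᵘ.≤-Reasoning
      distrib : ∀ x y m → (x ℤ.+ y) ℤ.* (m ℤ.* m) ≡ (x ℤ.* m ℤ.+ y ℤ.* m) ℤ.* m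
      distrib = ℤ-Solver.solve-∀
      cross : + (k + l) ℤ.* + (M * M) ≡ (+ k ℤ.* + M ℤ.+ + l ℤ.* + M) ℤ.* + M
      cross = trans (cong₂ ℤ._*_ (ℤ.pos-+ k l) (ℤ.pos-* M M)) (distrib (+ k) (+ l) (+ M))

  sumℚ-/M : ∀ (h : ℕ → ℕ) xs → sumℚ (map (λ x → h x /M) xs) ≡ sum (map h xs) /M
  sumℚ-/M h []       = sym 0/M≡0
  sumℚ-/M h (x ∷ xs) = trans (cong (h x /M +ℚ_) (sumℚ-/M h xs)) (sym (/M-homo-+ (h x) _))

Pointwise-map⁺ʳ : ∀ {A B : Set} {R : A → B → Set} (f : A → B) →
                  (∀ x → R x (f x)) → ∀ xs → Pointwise R xs (map f xs)
Pointwise-map⁺ʳ f r []       = []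
Pointwise-map⁺ʳ f r (x ∷ xs) = r x ∷ Pointwise-map⁺ʳ f r xs

sqrtSumLt-scaled : ∀ M .{{_ : NonZero M}} (f g : ℕ → ℕ) {bs as : List ℕ} →
  (∀ b → b * (M * M) ≤ f b * f b) → (∀ a → g a * g a ≤ a * (M * M)) →
  sum (map f bs) < sum (map g as) → SqrtSumLt bs as
sqrtSumLt-scaled (suc D) f g {bs} {as} f≥M√ g≤M√ Σf<Σg =
  map (λ b → f b /M) bs , map (λ a → g a /M) as ,
  Pointwise-map⁺ʳ _ (λ b → 0≤/M (f b) , ≤[/M]² b (f b) (f≥M√ b)) bs ,
  Pointwise-map⁺ʳ _ (λ a → 0≤/M (g a) , [/M]²≤ a (g a) (g≤M√ a)) as ,
  subst₂ _<ℚ_ (sym (sumℚ-/M f bs)) (sym (sumℚ-/M g as)) (/M-mono-< Σf<Σg)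
  where open ScaledRationals D

-- Sums over Fin n

sum-tabulate : ∀ (f : Fin n → ℕ) → sum (tabulate f) ≡ ∑ f
sum-tabulate {zero}  f = refl
sum-tabulate {suc n} f = cong (f zero +_) (sum-tabulate (f ∘ suc))

sum-map-allFin : ∀ (f : Fin n → ℕ) → sum (map f (allFin n)) ≡ ∑ f
sum-map-allFin f = trans (cong sum (map-tabulate id f)) (sum-tabulate f)

sum-map-concatMap : ∀ {A B : Set} (h : B → ℕ) (f : A → List B) xs →
  sum (map h (concatMap f xs)) ≡ sum (map (λ x → sum (map h (f x))) xs)
sum-map-concatMap h f []       = refl
sum-map-concatMap h f (x ∷ xs) = begin
  sum (map h (f x ++ concatMap f xs))                         ≡⟨ cong sum (map-++ h (f x) _) ⟩
  sum (map h (f x) ++ map h (concatMap f xs))                  ≡⟨ sum-++ (map h (f x)) _ ⟩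
  sum (map h (f x)) + sum (map h (concatMap f xs))             ≡⟨ cong (_ +_) (sum-map-concatMap h f xs) ⟩
  sum (map h (f x)) + sum (map (λ x → sum (map h (f x))) xs)   ∎
  where open ≡-Reasoning

∑-mono-≤ : ∀ {f g : Fin n → ℕ} → (∀ i → f i ≤ g i) → ∑ f ≤ ∑ g
∑-mono-≤ {zero}  f≤g = z≤n
∑-mono-≤ {suc n} f≤g = +-mono-≤ (f≤g zero) (∑-mono-≤ (f≤g ∘ suc))

∑-zero : ∀ {f : Fin n → ℕ} → (∀ i → f i ≡ 0) → ∑ f ≡ 0
∑-zero {n} f≡0 = trans (sum-cong-≗ f≡0) (sum-replicate-zero n)

∑-single : ∀ {f : Fin n → ℕ} j → (∀ i → i ≢ j → f i ≡ 0) → ∑ f ≡ f j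
∑-single {suc n} {f} j f≡0 = begin
  ∑ f                                 ≡⟨ sum-remove {i = j} f ⟩
  f j + ∑ (λ k → f (punchIn j k))     ≡⟨ cong (f j +_) (∑-zero (λ k → f≡0 _ (punchInᵢ≢i j k))) ⟩
  f j + 0                             ≡⟨ +-identityʳ (f j) ⟩
  f j                                 ∎
  where open ≡-Reasoning

∑-pair : ∀ {f : Fin n → ℕ} {x y} → x ≢ y → (∀ i → i ≢ x → i ≢ y → f i ≡ 0) → ∑ f ≡ f x + f y
∑-pair {suc n} {f} {x} {y} x≢y f≡0 = begin
  ∑ f                       ≡⟨ sum-remove {i = x} f ⟩
  f x + ∑ (f ∘ punchIn x)   ≡⟨ cong (f x +_) (∑-single j off-j) ⟩
  f x + f (punchIn x j)     ≡⟨ cong (λ i → f x + f i) (punchIn-punchOut x≢y) ⟩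
  f x + f y                 ∎
  where
    open ≡-Reasoning
    j : Fin n
    j = punchOut x≢y
    off-j : ∀ k → k ≢ j → f (punchIn x k) ≡ 0
    off-j k k≢j = f≡0 _ (punchInᵢ≢i x k) λ xk≡y →
      k≢j (punchIn-injective x k j (trans xk≡y (sym (punchIn-punchOut x≢y))))

-- Degrees, edges and edge weights

𝟙 : Bool → ℕ
𝟙 b = if b then 1 else 0

𝟙≤1 : ∀ b → 𝟙 b ≤ 1
𝟙≤1 true  = ≤-refl
𝟙≤1 false = z≤n

𝟙-mono : ∀ {b c} → (b ≡ true → c ≡ true) → 𝟙 b ≤ 𝟙 c
𝟙-mono {false} b⇒c = z≤n
𝟙-mono {true}  b⇒c rewrite b⇒c refl = ≤-refl

δ : Fin n → Fin n → ℕ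
δ x i = 𝟙 (isYes (i ≟ x))

δ-self : ∀ (x : Fin n) → δ x x ≡ 1
δ-self x with x ≟ x
... | yes _   = refl
... | no x≢x  = contradiction refl x≢x

δ-other : ∀ {x i : Fin n} → i ≢ x → δ x i ≡ 0
δ-other {x = x} {i} i≢x with i ≟ x
... | yes i≡x = contradiction i≡x i≢x
... | no _    = refl

∑-δ : ∀ (x : Fin n) → ∑ (δ x) ≡ 1
∑-δ x = trans (∑-single x (λ i → δ-other)) (δ-self x)

deg≡∑ : ∀ (A : Adj n) c → deg A c ≡ ∑[ b < n ] 𝟙 (A c b)
deg≡∑ A c = sum-map-allFin (λ b → 𝟙 (A c b))

deg-mono : ∀ (A B : Adj n) {c} → (∀ b → A c b ≡ true → B c b ≡ true) → deg A c ≤ deg B c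
deg-mono A B {c} A⇒B = subst₂ _≤_ (sym (deg≡∑ A c)) (sym (deg≡∑ B c)) (∑-mono-≤ (λ b → 𝟙-mono (A⇒B b)))

∑-δ+δ : ∀ (x y : Fin n) → ∑[ b < n ] (δ x b + δ y b) ≡ 2
∑-δ+δ x y = trans (∑-distrib-+ (δ x) (δ y)) (cong₂ _+_ (∑-δ x) (∑-δ y))

deg≤2 : ∀ (A : Adj n) {c} x y → (∀ b → A c b ≡ true → b ≡ x ⊎ b ≡ y) → deg A c ≤ 2
deg≤2 A {c} x y nbrs = subst₂ _≤_ (sym (deg≡∑ A c)) (∑-δ+δ x y) (∑-mono-≤ pointwise)
  where
    pointwise : ∀ b → 𝟙 (A c b) ≤ δ x b + δ y b
    pointwise b with A c b in c~b | b ≟ x | b ≟ y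
    ... | false | _        | _        = z≤n
    ... | true  | yes _    | _        = s≤s z≤n
    ... | true  | no _     | yes _    = ≤-refl
    ... | true  | no b≢x   | no b≢y   = contradiction (nbrs b c~b) [ b≢x , b≢y ]′

2≤deg : ∀ (A : Adj n) {c x y} → x ≢ y → A c x ≡ true → A c y ≡ true → 2 ≤ deg A c
2≤deg A {c} {x} {y} x≢y c~x c~y = subst₂ _≤_ (∑-δ+δ x y) (sym (deg≡∑ A c)) (∑-mono-≤ pointwise)
  where
    pointwise : ∀ b → δ x b + δ y b ≤ 𝟙 (A c b)
    pointwise b with b ≟ x | b ≟ y
    ... | yes refl | yes refl = contradiction refl x≢y
    ... | yes refl | no _     rewrite c~x = ≤-refl
    ... | no _     | yes refl rewrite c~y = ≤-refl
    ... | no _     | no _     = z≤n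

deg-exchange : ∀ (A B : Adj n) {c} x y → A c x ≡ false → B c x ≡ true →
               (∀ b → b ≢ y → A c b ≡ true → B c b ≡ true) → deg A c ≤ deg B c
deg-exchange A B {c} x y c≁x c~x A⇒B = +-cancelʳ-≤ 1 (deg A c) (deg B c) (subst₂ _≤_
    (trans (∑-distrib-+ _ (δ x)) (cong₂ _+_ (sym (deg≡∑ A c)) (∑-δ x)))
    (trans (∑-distrib-+ _ (δ y)) (cong₂ _+_ (sym (deg≡∑ B c)) (∑-δ y)))
    (∑-mono-≤ pointwise))
  where
    pointwise : ∀ b → 𝟙 (A c b) + δ x b ≤ 𝟙 (B c b) + δ y b
    pointwise b with b ≟ x | b ≟ y
    ... | yes refl | _        rewrite c≁x | c~x = m≤m+n 1 _
    ... | no _     | yes refl = ≤-trans (+-monoˡ-≤ 0 (𝟙≤1 (A c y))) (m≤n+m 1 (𝟙 (B c y)))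
    ... | no _     | no b≢y   = +-monoˡ-≤ 0 (𝟙-mono (A⇒B b b≢y))

SameEdge : Fin n → Fin n → Fin n → Fin n → Set
SameEdge a b x y = (a ≡ x × b ≡ y) ⊎ (a ≡ y × b ≡ x)

isYes-reflects : ∀ {A : Set} (a? : Dec A) → Reflects A (isYes a?)
isYes-reflects (yes a) = ofʸ a
isYes-reflects (no ¬a) = ofⁿ ¬a

sameEdge-reflects : ∀ (a b x y : Fin n) → Reflects (SameEdge a b x y) (sameEdge a b x y)
sameEdge-reflects a b x y =
  (isYes-reflects (a ≟ x) ×-reflects isYes-reflects (b ≟ y)) ⊎-reflects
  (isYes-reflects (a ≟ y) ×-reflects isYes-reflects (b ≟ x))

sameEdge? : ∀ (a b x y : Fin n) → Dec (SameEdge a b x y)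
sameEdge? a b x y = sameEdge a b x y because sameEdge-reflects a b x y

module _ (A : Adj n) (u w z : Fin n) {a b : Fin n} where

  moveEdge-removed : SameEdge a b u w → moveEdge A u w z a b ≡ false
  moveEdge-removed ab=uw with sameEdge a b u w | sameEdge-reflects a b u w
  ... | true  | _        = refl
  ... | false | ofⁿ ab≠uw = contradiction ab=uw ab≠uw

  moveEdge-added : ¬ SameEdge a b u w → SameEdge a b z w → moveEdge A u w z a b ≡ true
  moveEdge-added ab≠uw ab=zw
    with sameEdge a b u w | sameEdge-reflects a b u w | sameEdge a b z w | sameEdge-reflects a b z w
  ... | true  | ofʸ ab=uw | _     | _         = contradiction ab=uw ab≠uw
  ... | false | _         | true  | _         = refl
  ... | false | _         | false | ofⁿ ab≠zw = contradiction ab=zw ab≠zw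

  moveEdge-kept : ¬ SameEdge a b u w → ¬ SameEdge a b z w → moveEdge A u w z a b ≡ A a b
  moveEdge-kept ab≠uw ab≠zw
    with sameEdge a b u w | sameEdge-reflects a b u w | sameEdge a b z w | sameEdge-reflects a b z w
  ... | true  | ofʸ ab=uw | _     | _         = contradiction ab=uw ab≠uw
  ... | false | _         | true  | ofʸ ab=zw = contradiction ab=zw ab≠zw
  ... | false | _         | false | _         = refl

onEdge : Fin n → Fin n → (Fin n → Fin n → ℕ) → Fin n → Fin n → ℕ
onEdge x y F a b = if sameEdge a b x y then F a b else 0

module _ {x y a b : Fin n} (F : Fin n → Fin n → ℕ) where

  onEdge-on : SameEdge a b x y → onEdge x y F a b ≡ F a b
  onEdge-on ab=xy with sameEdge a b x y | sameEdge-reflects a b x y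
  ... | true  | _         = refl
  ... | false | ofⁿ ab≠xy = contradiction ab=xy ab≠xy

  onEdge-off : ¬ SameEdge a b x y → onEdge x y F a b ≡ 0
  onEdge-off ab≠xy with sameEdge a b x y | sameEdge-reflects a b x y
  ... | true  | ofʸ ab=xy = contradiction ab=xy ab≠xy
  ... | false | _         = refl

∑∑ : (Fin n → Fin n → ℕ) → ℕ
∑∑ {n} F = ∑[ a < n ] ∑[ b < n ] F a b

∑∑-mono-≤ : ∀ {F G : Fin n → Fin n → ℕ} → (∀ a b → F a b ≤ G a b) → ∑∑ F ≤ ∑∑ G
∑∑-mono-≤ F≤G = ∑-mono-≤ (λ a → ∑-mono-≤ (F≤G a))

∑∑-distrib-+ : ∀ (F G : Fin n → Fin n → ℕ) → ∑∑ (λ a b → F a b + G a b) ≡ ∑∑ F + ∑∑ G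
∑∑-distrib-+ {n} F G =
  trans (sum-cong-≗ {n} (λ a → ∑-distrib-+ (F a) (G a))) (∑-distrib-+ (λ a → ∑ (F a)) (λ a → ∑ (G a)))

∑∑-onEdge : ∀ {x y : Fin n} (F : Fin n → Fin n → ℕ) → x ≢ y → ∑∑ (onEdge x y F) ≡ F x y + F y x
∑∑-onEdge {n} {x} {y} F x≢y = begin
  ∑∑ (onEdge x y F)                     ≡⟨ ∑-pair x≢y off-rows ⟩
  row x + row y                         ≡⟨ cong₂ _+_ (∑-single y off-x) (∑-single x off-y) ⟩
  onEdge x y F x y + onEdge x y F y x   ≡⟨ cong₂ _+_ (onEdge-on F (inj₁ (refl , refl)))
                                                     (onEdge-on F (inj₂ (refl , refl))) ⟩
  F x y + F y x                         ∎
  where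
    open ≡-Reasoning
    row : Fin n → ℕ
    row a = ∑[ b < n ] onEdge x y F a b
    off-rows : ∀ a → a ≢ x → a ≢ y → row a ≡ 0
    off-rows a a≢x a≢y = ∑-zero λ b → onEdge-off {a = a} {b} F [ a≢x ∘ proj₁ , a≢y ∘ proj₁ ]′
    off-x : ∀ b → b ≢ y → onEdge x y F x b ≡ 0
    off-x b b≢y = onEdge-off {b = b} F [ b≢y ∘ proj₂ , x≢y ∘ proj₁ ]′
    off-y : ∀ b → b ≢ x → onEdge x y F y b ≡ 0
    off-y b b≢x = onEdge-off {b = b} F [ x≢y ∘ sym ∘ proj₁ , b≢x ∘ proj₂ ]′

radicand : Adj n → Fin n → Fin n → ℕ
radicand A a b = deg A a * deg A a + deg A b * deg A b

edgeWeight : Adj n → (ℕ → ℕ) → Fin n → Fin n → ℕ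
edgeWeight A h a b = if (toℕ a <ᵇ toℕ b) ∧ A a b then h (radicand A a b) else 0

sum-map-radicands : ∀ (A : Adj n) h → sum (map h (radicands A)) ≡ ∑∑ (edgeWeight A h)
sum-map-radicands {n} A h = begin
  sum (map h (radicands A))                          ≡⟨ sum-map-concatMap h row (allFin n) ⟩
  sum (map (λ a → sum (map h (row a))) (allFin n))   ≡⟨ sum-map-allFin (λ a → sum (map h (row a))) ⟩
  ∑[ a < n ] sum (map h (row a))                     ≡⟨ sum-cong-≗ {n} sum-row ⟩
  ∑∑ (edgeWeight A h)                                ∎
  where
    open ≡-Reasoning
    cell : Fin n → Fin n → List ℕ
    cell a b = if (toℕ a <ᵇ toℕ b) ∧ A a b then radicand A a b ∷ [] else []
    row : Fin n → List ℕ
    row a = concatMap (cell a) (allFin n)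
    sum-cell : ∀ a b → sum (map h (cell a b)) ≡ edgeWeight A h a b
    sum-cell a b with (toℕ a <ᵇ toℕ b) ∧ A a b
    ... | true  = +-identityʳ _
    ... | false = refl
    sum-row : ∀ a → sum (map h (row a)) ≡ ∑[ b < n ] edgeWeight A h a b
    sum-row a = trans (sum-map-concatMap h (cell a) (allFin n))
                      (trans (sum-map-allFin (λ b → sum (map h (cell a b)))) (sum-cong-≗ {n} (sum-cell a)))

module _ (A : Adj n) (a b : Fin n) where

  edgeWeight-nonEdge : ∀ h → A a b ≡ false → edgeWeight A h a b ≡ 0
  edgeWeight-nonEdge h a≁b rewrite a≁b | ∧-zeroʳ (toℕ a <ᵇ toℕ b) = refl

  edgeWeight-suc : ∀ h → edgeWeight A (suc ∘ h) a b ≤ suc (edgeWeight A h a b)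
  edgeWeight-suc h with (toℕ a <ᵇ toℕ b) ∧ A a b
  ... | true  = ≤-refl
  ... | false = z≤n

  edgeWeight-mono : ∀ (B : Adj n) h k → (A a b ≡ true → B a b ≡ true × h (radicand A a b) ≤ k (radicand B a b)) →
                    edgeWeight A h a b ≤ edgeWeight B k a b
  edgeWeight-mono B h k A⇒B with toℕ a <ᵇ toℕ b | A a b in a~b
  ... | false | _     = z≤n
  ... | true  | false = z≤n
  ... | true  | true  with A⇒B refl
  ...   | b~a , h≤k rewrite b~a = h≤k

edgeWeight-edge : ∀ (A : Adj n) h {x y} → x ≢ y → A x y ≡ true → A y x ≡ true →
                  edgeWeight A h x y + edgeWeight A h y x ≡ h (radicand A x y)
edgeWeight-edge A h {x} {y} x≢y x~y y~x
  with toℕ x <ᵇ toℕ y | <ᵇ-reflects-< (toℕ x) (toℕ y) | toℕ y <ᵇ toℕ x | <ᵇ-reflects-< (toℕ y) (toℕ x)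
... | true  | ofʸ x<y | true  | ofʸ y<x = contradiction y<x (<-asym x<y)
... | true  | _       | false | _       rewrite x~y = +-identityʳ _
... | false | _       | true  | _       rewrite y~x = cong h (+-comm (deg A y * deg A y) (deg A x * deg A x))
... | false | ofⁿ x≮y | false | ofⁿ y≮x = contradiction (toℕ-injective (≤-antisym (≮⇒≥ y≮x) (≮⇒≥ x≮y))) x≢y

∑∑-edgeWeight-suc : ∀ (A : Adj n) h → ∑∑ (edgeWeight A (suc ∘ h)) ≤ ∑∑ {n} (λ _ _ → 1) + ∑∑ (edgeWeight A h)
∑∑-edgeWeight-suc A h = subst (∑∑ (edgeWeight A (suc ∘ h)) ≤_) (∑∑-distrib-+ (λ _ _ → 1) (edgeWeight A h))
  (∑∑-mono-≤ (λ a b → edgeWeight-suc A a b h))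

-- Moving the edge uw to zw

module EdgeMove {n} (A : Adj n) (A-sym : ∀ a b → A a b ≡ A b a)
  {u w z q : Fin n} (u~w : A u w ≡ true) (z~q : A z q ≡ true) (z≢w : z ≢ w)
  (deg-z≡1 : deg A z ≡ 1) (3≤deg-u : 3 ≤ deg A u) (deg-w≤2 : deg A w ≤ 2) (2≤deg-q : 2 ≤ deg A q) where

  A′ : Adj n
  A′ = moveEdge A u w z

  private
    u≢w : u ≢ w
    u≢w refl = contradiction (≤-trans 3≤deg-u deg-w≤2) (from-no (3 ≤? 2))

    z≢u : z ≢ u
    z≢u refl = contradiction (subst (3 ≤_) deg-z≡1 3≤deg-u) (from-no (3 ≤? 1))

    z≢q : z ≢ q
    z≢q refl = contradiction (subst (2 ≤_) deg-z≡1 2≤deg-q) (from-no (2 ≤? 1))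

    z-neighbour : ∀ {b} → A z b ≡ true → b ≡ q
    z-neighbour {b} z~b with b ≟ q
    ... | yes b≡q = b≡q
    ... | no  b≢q = contradiction (subst (2 ≤_) deg-z≡1 (2≤deg A b≢q z~b z~q)) (from-no (2 ≤? 1))

    zy≠uw : ∀ {a b y} → SameEdge a b z y → ¬ SameEdge a b u w
    zy≠uw (inj₁ (refl , _)) (inj₁ (a≡u , _)) = z≢u a≡u
    zy≠uw (inj₁ (refl , _)) (inj₂ (a≡w , _)) = z≢w a≡w
    zy≠uw (inj₂ (_ , refl)) (inj₁ (_ , b≡w)) = z≢w b≡w
    zy≠uw (inj₂ (_ , refl)) (inj₂ (_ , b≡u)) = z≢u b≡u

    A′⇒A : ∀ {a b} → ¬ SameEdge a b z w → A′ a b ≡ true → A a b ≡ true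
    A′⇒A {a} {b} ab≠zw a~′b with sameEdge? a b u w
    ... | yes ab=uw = contradiction (trans (sym a~′b) (moveEdge-removed A u w z ab=uw)) λ ()
    ... | no  ab≠uw = trans (sym (moveEdge-kept A u w z ab≠uw ab≠zw)) a~′b

    A′-zq : ∀ {a b} → SameEdge a b z q → A′ a b ≡ true
    A′-zq {a} {b} ab=zq with sameEdge? a b z w
    ... | yes ab=zw = moveEdge-added A u w z (zy≠uw ab=zw) ab=zw
    ... | no  ab≠zw = trans (moveEdge-kept A u w z (zy≠uw ab=zq) ab≠zw) (A-zq ab=zq)
      where
        A-zq : ∀ {a b} → SameEdge a b z q → A a b ≡ true
        A-zq (inj₁ (refl , refl)) = z~q
        A-zq (inj₂ (refl , refl)) = trans (A-sym q z) z~q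

    deg′-w≤deg-w : deg A′ w ≤ deg A w
    deg′-w≤deg-w = deg-exchange A′ A u z (moveEdge-removed A u w z (inj₂ (refl , refl))) (trans (A-sym w u) u~w)
      (λ b b≢z → A′⇒A {w} {b} λ { (inj₁ (w≡z , _)) → z≢w (sym w≡z) ; (inj₂ (_ , b≡z)) → b≢z b≡z })

    deg′≤deg : ∀ {c} → c ≢ z → deg A′ c ≤ deg A c
    deg′≤deg {c} c≢z = by-cases (c ≟ w)
      where
        by-cases : Dec (c ≡ w) → deg A′ c ≤ deg A c
        by-cases (yes refl) = deg′-w≤deg-w
        by-cases (no c≢w)   = deg-mono A′ A λ b →
          A′⇒A {c} {b} λ { (inj₁ (c≡z , _)) → c≢z c≡z ; (inj₂ (c≡w , _)) → c≢w c≡w }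

    deg′-z≤2 : deg A′ z ≤ 2
    deg′-z≤2 = deg≤2 A′ {z} q w neighbours
      where
        neighbours : ∀ b → A′ z b ≡ true → b ≡ q ⊎ b ≡ w
        neighbours b z~′b with sameEdge? z b z w
        ... | yes (inj₁ (_ , b≡w)) = inj₂ b≡w
        ... | yes (inj₂ (z≡w , _)) = contradiction z≡w z≢w
        ... | no  zb≠zw            = inj₁ (z-neighbour (A′⇒A {z} {b} zb≠zw z~′b))

    radicand′≤radicand : ∀ {a b} → a ≢ z → b ≢ z → radicand A′ a b ≤ radicand A a b
    radicand′≤radicand a≢z b≢z =
      +-mono-≤ (*-mono-≤ (deg′≤deg a≢z) (deg′≤deg a≢z)) (*-mono-≤ (deg′≤deg b≢z) (deg′≤deg b≢z))

    radicand′-z≤4+ : ∀ {c} → c ≢ z → radicand A′ z c ≤ 4 + deg A c * deg A c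
    radicand′-z≤4+ c≢z = +-mono-≤ (*-mono-≤ deg′-z≤2 deg′-z≤2) (*-mono-≤ (deg′≤deg c≢z) (deg′≤deg c≢z))

    radicand-zq : radicand A z q ≡ 1 + deg A q * deg A q
    radicand-zq = cong (λ d → d * d + deg A q * deg A q) deg-z≡1

    avoids-z : ∀ {a b} → ¬ SameEdge a b z q → A a b ≡ true → a ≢ z × b ≢ z
    avoids-z ab≠zq a~b = (λ { refl → ab≠zq (inj₁ (refl , z-neighbour a~b)) })
                          , (λ { refl → ab≠zq (inj₂ (z-neighbour (trans (A-sym z _) a~b) , refl)) })

  N : ℕ
  N = ∑∑ {n} (λ _ _ → 1)

  open ScaledSqrt (suc N)

  W′ W V′ : Fin n → Fin n → ℕ
  W′ = edgeWeight A′ (suc ∘ ⌊M√_⌋)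
  W  = edgeWeight A ⌊M√_⌋
  V′ = edgeWeight A′ ⌊M√_⌋

  -- Away from the edges uw, zw and zq, V′ ≤ W pointwise; gain and loss collect the exceptions.
  gain loss : Fin n → Fin n → ℕ
  gain a b = onEdge u w W a b + onEdge z q W a b
  loss a b = onEdge z w V′ a b + onEdge z q V′ a b

  V′+gain≤W+loss : ∀ a b → V′ a b + gain a b ≤ W a b + loss a b
  V′+gain≤W+loss a b with sameEdge? a b z q | sameEdge? a b z w | sameEdge? a b u w
  ... | yes ab=zq | _ | _ = begin
    V′ a b + gain a b                     ≡⟨ cong (V′ a b +_)
                                               (cong₂ _+_ (onEdge-off W (zy≠uw ab=zq)) (onEdge-on W ab=zq)) ⟩
    V′ a b + W a b                        ≡⟨ +-comm (V′ a b) (W a b) ⟩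
    W a b + V′ a b                        ≤⟨ +-monoʳ-≤ (W a b) (m≤n+m (V′ a b) (onEdge z w V′ a b)) ⟩
    W a b + (onEdge z w V′ a b + V′ a b)  ≡⟨ cong (λ l → W a b + (onEdge z w V′ a b + l)) (onEdge-on V′ ab=zq) ⟨
    W a b + loss a b                      ∎
    where open ≤-Reasoning
  ... | no ab≠zq | yes ab=zw | _ = begin
    V′ a b + gain a b                     ≡⟨ cong (V′ a b +_)
                                               (cong₂ _+_ (onEdge-off W (zy≠uw ab=zw)) (onEdge-off W ab≠zq)) ⟩
    V′ a b + 0                            ≤⟨ m≤n+m (V′ a b + 0) (W a b) ⟩
    W a b + (V′ a b + 0)                  ≡⟨ cong (W a b +_) (cong₂ _+_ (onEdge-on V′ ab=zw) (onEdge-off V′ ab≠zq)) ⟨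
    W a b + loss a b                      ∎
    where open ≤-Reasoning
  ... | no ab≠zq | no ab≠zw | yes ab=uw = begin
    V′ a b + gain a b                     ≡⟨ cong₂ _+_
                                               (edgeWeight-nonEdge A′ a b ⌊M√_⌋ (moveEdge-removed A u w z ab=uw))
                                               (cong₂ _+_ (onEdge-on W ab=uw) (onEdge-off W ab≠zq)) ⟩
    W a b + 0                             ≡⟨ cong (W a b +_) (cong₂ _+_ (onEdge-off V′ ab≠zw) (onEdge-off V′ ab≠zq)) ⟨
    W a b + loss a b                      ∎
    where open ≤-Reasoning
  ... | no ab≠zq | no ab≠zw | no ab≠uw = begin
    V′ a b + gain a b                     ≡⟨ cong (V′ a b +_) (cong₂ _+_ (onEdge-off W ab≠uw) (onEdge-off W ab≠zq)) ⟩
    V′ a b + 0                            ≤⟨ +-monoˡ-≤ 0 (edgeWeight-mono A′ a b A ⌊M√_⌋ ⌊M√_⌋ kept) ⟩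
    W a b + 0                             ≡⟨ cong (W a b +_) (cong₂ _+_ (onEdge-off V′ ab≠zw) (onEdge-off V′ ab≠zq)) ⟨
    W a b + loss a b                      ∎
    where
      open ≤-Reasoning
      kept : A′ a b ≡ true → A a b ≡ true × ⌊M√ radicand A′ a b ⌋ ≤ ⌊M√ radicand A a b ⌋
      kept a~′b with A′⇒A ab≠zw a~′b
      ... | a~b with avoids-z ab≠zq a~b
      ...   | a≢z , b≢z = a~b , ⌊M√⌋-mono-≤ (radicand′≤radicand a≢z b≢z)

  ∑∑-gain : ∑∑ gain ≡ ⌊M√ radicand A u w ⌋ + ⌊M√ radicand A z q ⌋
  ∑∑-gain = begin
    ∑∑ gain                                      ≡⟨ ∑∑-distrib-+ (onEdge u w W) (onEdge z q W) ⟩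
    ∑∑ (onEdge u w W) + ∑∑ (onEdge z q W)        ≡⟨ cong₂ _+_ (∑∑-onEdge W u≢w) (∑∑-onEdge W z≢q) ⟩
    (W u w + W w u) + (W z q + W q z)            ≡⟨ cong₂ _+_ (edgeWeight-edge A ⌊M√_⌋ u≢w u~w w~u)
                                                              (edgeWeight-edge A ⌊M√_⌋ z≢q z~q q~z) ⟩
    ⌊M√ radicand A u w ⌋ + ⌊M√ radicand A z q ⌋   ∎
    where
      open ≡-Reasoning
      w~u : A w u ≡ true
      w~u = trans (A-sym w u) u~w
      q~z : A q z ≡ true
      q~z = trans (A-sym q z) z~q

  ∑∑-loss : ∑∑ loss ≡ ⌊M√ radicand A′ z w ⌋ + ⌊M√ radicand A′ z q ⌋
  ∑∑-loss = begin
    ∑∑ loss                                      ≡⟨ ∑∑-distrib-+ (onEdge z w V′) (onEdge z q V′) ⟩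
    ∑∑ (onEdge z w V′) + ∑∑ (onEdge z q V′)      ≡⟨ cong₂ _+_ (∑∑-onEdge V′ z≢w) (∑∑-onEdge V′ z≢q) ⟩
    (V′ z w + V′ w z) + (V′ z q + V′ q z)        ≡⟨ cong₂ _+_ (edgeWeight-edge A′ ⌊M√_⌋ z≢w z~′w w~′z)
                                                              (edgeWeight-edge A′ ⌊M√_⌋ z≢q z~′q q~′z) ⟩
    ⌊M√ radicand A′ z w ⌋ + ⌊M√ radicand A′ z q ⌋ ∎
    where
      open ≡-Reasoning
      z~′w : A′ z w ≡ true
      z~′w = moveEdge-added A u w z (zy≠uw (inj₁ (refl , refl))) (inj₁ (refl , refl))
      w~′z : A′ w z ≡ true
      w~′z = moveEdge-added A u w z (zy≠uw (inj₂ (refl , refl))) (inj₂ (refl , refl))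
      z~′q : A′ z q ≡ true
      z~′q = A′-zq (inj₁ (refl , refl))
      q~′z : A′ q z ≡ true
      q~′z = A′-zq (inj₂ (refl , refl))

  N+loss<gain : N + ∑∑ loss < ∑∑ gain
  N+loss<gain = begin-strict
    N + ∑∑ loss                                     ≡⟨ cong (N +_) ∑∑-loss ⟩
    N + (⌊M√ radicand A′ z w ⌋ + ⌊M√ radicand A′ z q ⌋)
      ≤⟨ +-monoʳ-≤ N (+-mono-≤ (⌊M√⌋-mono-≤ (radicand′-z≤4+ (z≢w ∘ sym)))
                               (≤-trans (⌊M√⌋-mono-≤ (radicand′-z≤4+ (z≢q ∘ sym))) (⌊M√⌋-loss dq 2≤deg-q))) ⟩
    N + (⌊M√ 4 + dw * dw ⌋ + (⌊M√ 1 + dq * dq ⌋ + 65 * suc N))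
      <⟨ slack N ⌊M√ 4 + dw * dw ⌋ ⌊M√ 1 + dq * dq ⌋ ⟩
    ⌊M√ 4 + dw * dw ⌋ + 77 * suc N + ⌊M√ 1 + dq * dq ⌋
      ≤⟨ +-monoˡ-≤ ⌊M√ 1 + dq * dq ⌋ (⌊M√⌋-gain (deg A u) dw 3≤deg-u deg-w≤2) ⟩
    ⌊M√ radicand A u w ⌋ + ⌊M√ 1 + dq * dq ⌋        ≡⟨ cong (λ r → ⌊M√ radicand A u w ⌋ + ⌊M√ r ⌋) radicand-zq ⟨
    ⌊M√ radicand A u w ⌋ + ⌊M√ radicand A z q ⌋     ≡⟨ ∑∑-gain ⟨
    ∑∑ gain                                         ∎
    where
      open ≤-Reasoning
      dw dq : ℕ
      dw = deg A w
      dq = deg A q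
      rearrange : ∀ N x y → x + 77 * suc N + y ≡ suc (N + (x + (y + 65 * suc N))) + 11 * suc N
      rearrange = solve-∀
      slack : ∀ N x y → N + (x + (y + 65 * suc N)) < x + 77 * suc N + y
      slack N x y = subst (N + (x + (y + 65 * suc N)) <_) (sym (rearrange N x y)) (m≤m+n _ (11 * suc N))

  ∑∑W′<∑∑W : ∑∑ W′ < ∑∑ W
  ∑∑W′<∑∑W = +-cancelʳ-< (∑∑ gain) (∑∑ W′) (∑∑ W) (begin-strict
    ∑∑ W′ + ∑∑ gain                      ≤⟨ +-monoˡ-≤ (∑∑ gain) (∑∑-edgeWeight-suc A′ ⌊M√_⌋) ⟩
    N + ∑∑ V′ + ∑∑ gain                  ≡⟨ +-assoc N (∑∑ V′) (∑∑ gain) ⟩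
    N + (∑∑ V′ + ∑∑ gain)                ≡⟨ cong (N +_) (∑∑-distrib-+ V′ gain) ⟨
    N + ∑∑ (λ a b → V′ a b + gain a b)   ≤⟨ +-monoʳ-≤ N (∑∑-mono-≤ V′+gain≤W+loss) ⟩
    N + ∑∑ (λ a b → W a b + loss a b)    ≡⟨ cong (N +_) (∑∑-distrib-+ W loss) ⟩
    N + (∑∑ W + ∑∑ loss)                 ≡⟨ x∙yz≈y∙xz N (∑∑ W) (∑∑ loss) ⟩
    ∑∑ W + (N + ∑∑ loss)                 <⟨ +-monoʳ-< (∑∑ W) N+loss<gain ⟩
    ∑∑ W + ∑∑ gain                       ∎)
    where open ≤-Reasoning

  SO-decreases : SOlt A′ A
  SO-decreases = sqrtSumLt-scaled M (suc ∘ ⌊M√_⌋) ⌊M√_⌋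
    (λ b → <⇒≤ (n<[1+⌊√n⌋]² (b * (M * M))))
    (λ a → ⌊√n⌋²≤n (a * (M * M)))
    (subst₂ _<_ (sym (sum-map-radicands A′ (suc ∘ ⌊M√_⌋))) (sym (sum-map-radicands A ⌊M√_⌋)) ∑∑W′<∑∑W)

-- Pendent paths

module _ {n} {A : Adj n} where
  open PendentPath

  second-adjacent : ∀ {u k} (P : PendentPath A u k) → A u (second P) ≡ true
  second-adjacent {k = zero}  P = contradiction (lenPos P) λ ()
  second-adjacent {k = suc k} P = subst (λ r → A r (second P) ≡ true) (start P) (adjacent P zero)

  second-endpoint-or-deg2 : ∀ {u k} (P : PendentPath A u k) → second P ≡ endpoint P ⊎ deg A (second P) ≡ 2
  second-endpoint-or-deg2 {k = zero}        P = contradiction (lenPos P) λ ()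
  second-endpoint-or-deg2 {k = suc zero}    P = inj₁ refl
  second-endpoint-or-deg2 {k = suc (suc k)} P = inj₂ (midDeg P (suc zero) (s≤s z≤n) (s≤s (s≤s z≤n)))

  deg-second≤2 : ∀ {u k} (P : PendentPath A u k) → deg A (second P) ≤ 2
  deg-second≤2 P with second-endpoint-or-deg2 P
  ... | inj₁ w≡z  = ≤-trans (≤-reflexive (trans (cong (deg A) w≡z) (endDeg P))) (n≤1+n 1)
  ... | inj₂ deg≡2 = ≤-reflexive deg≡2

  endpoint≢second : ∀ {u v k j} (P : PendentPath A u k) (Q : PendentPath A v j) →
                    endpoint P ≢ endpoint Q → endpoint Q ≢ second P
  endpoint≢second P Q zP≢zQ zQ≡w with second-endpoint-or-deg2 P
  ... | inj₁ w≡zP  = zP≢zQ (sym (trans zQ≡w w≡zP))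
  ... | inj₂ deg≡2 = contradiction (trans (sym (endDeg Q)) (trans (cong (deg A) zQ≡w) deg≡2)) λ ()

  2≤deg-penultimate : ∀ {v j} (P : PendentPath A v (suc j)) → 2 ≤ deg A (p P (inject₁ (fromℕ j)))
  2≤deg-penultimate {j = zero}  P = ≤-trans (n≤1+n 2) (subst (λ r → 3 ≤ deg A r) (sym (start P)) (rootDeg P))
  2≤deg-penultimate {j = suc j} P = ≤-reflexive (sym (midDeg P (inject₁ (fromℕ (suc j))) (s≤s z≤n)
    (subst (_< suc (suc j)) (sym (toℕ-inject₁ (fromℕ (suc j)))) (toℕ<n (fromℕ (suc j))))))

  endpoint-neighbour : (∀ a b → A a b ≡ A b a) → ∀ {v j} (P : PendentPath A v j) →
                       ∃[ q ] A (endpoint P) q ≡ true × 2 ≤ deg A q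
  endpoint-neighbour A-sym {j = zero}  P = contradiction (lenPos P) λ ()
  endpoint-neighbour A-sym {j = suc j} P =
    p P (inject₁ (fromℕ j)) , trans (A-sym _ _) (adjacent P (fromℕ j)) , 2≤deg-penultimate P

lemma4p9 : ∀ {n} (adj : Adj n) → IsSimple adj →
    (u v : Fin n) (k j : ℕ) (Pk : PendentPath adj u k) (Pj : PendentPath adj v j) →
    PendentPath.endpoint Pk ≢ PendentPath.endpoint Pj →
    deg adj v ≤ deg adj u →
    SOlt (moveEdge adj u (PendentPath.second Pk) (PendentPath.endpoint Pj)) adj
lemma4p9 adj (adj-sym , _) u v k j Pk Pj zk≢zj _ with endpoint-neighbour adj-sym Pj
... | q , z~q , 2≤deg-q =
  EdgeMove.SO-decreases adj adj-sym (second-adjacent Pk) z~q (endpoint≢second Pk Pj zk≢zj)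
    (PendentPath.endDeg Pj) (PendentPath.rootDeg Pk) (deg-second≤2 Pk) 2≤deg-q
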